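{- Let $m$ be a positive integer, let $s^{ -1}(m)=\max\{n\ge 0: s_n\le m\}$, and let $\phi(m)$ be the sum of the coefficients $\varepsilon_i$ in the $\mu$-expansion $m=r+\varepsilon_1\mu_1+\cdots+\varepsilon_\ell\mu_\ell$ of $m$. Then there exists an integer $r\in\{0,1,2,3,4\}$ such that \[ m-r=3s^{ -1}(m)+2\phi(m). \]
   Context: Sequence $s_n$: let $A_1=(5)$ and for $k\ge2$ let $A_k$ be the concatenation $A_{k-1},A_{k-1},(1)$; $A$ is the limiting infinite list; $a_0=0$, $a_n$ is the $n$th entry of $A$ for $n\ge1$, and $s_n=a_0+\cdots+a_n$. For $i\ge1$ let $M_i=2^i-1$ and $\mu_i=3M_i+2=3\cdot 2^i-1$. The $\mu$-expansion of a positive integer $n$ is obtained greedily: if $n\le 4$, stop (remainder $r=n$, no further terms). Otherwise let $\ell=\max\{i:n\ge\mu_i\}$ and write $n=\mu_\ell+r'$ with $0\le r'\le\mu_\ell$; if $r'=0$, stop with $n=\mu_\ell$; if $r'=\mu_\ell$, stop with $n=2\mu_\ell$; otherwise continue the process with $r'$. This yields $n=r+\varepsilon_1\mu_1+\cdots+\varepsilon_\ell\mu_\ell$ with $r\in\{0,1,2,3,4\}$ and $\varepsilon_i\in\{0,1,2\}$ (and $\phi(n)=0$ if $n\le 4$). -}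

module Defs where

open import Data.Nat using (ℕ; zero; suc; _+_; _*_; _∸_; _^_; _≤_; _≤?_; _≤ᵇ_; _≡ᵇ_)
open import Data.Bool using (if_then_else_)
open import Data.List using (List; []; _∷_; _++_)
open import Relation.Nullary using (yes; no)

-- Ablock k = A_{k+1}:  A_1 = (5),  A_{k} = A_{k-1} ++ A_{k-1} ++ (1)
Ablock : ℕ → List ℕ
Ablock zero    = 5 ∷ []
Ablock (suc k) = Ablock k ++ Ablock k ++ (1 ∷ [])

-- 0-indexed lookup with default 0 (default never used below)
nth : List ℕ → ℕ → ℕ
nth []       _       = 0
nth (x ∷ xs) zero    = x
nth (x ∷ xs) (suc i) = nth xs i

-- a_0 = 0, a_n = n-th entry (1-indexed) of the limiting list A.
-- A_{n+2} = Ablock (suc n) has length 2^(n+2) - 1 > n and is a prefix of A.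
a : ℕ → ℕ
a zero    = 0
a (suc n) = nth (Ablock (suc n)) n

s : ℕ → ℕ
s zero    = a zero
s (suc n) = s n + a (suc n)

IsSInv : ℕ → ℕ → Set
IsSInv m n = (s n ≤ m) × (∀ k → s k ≤ m → k ≤ n)
  where open import Data.Product using (_×_)

μ : ℕ → ℕ
μ i = 3 * 2 ^ i ∸ 1

-- largest ℓ ≥ i with μ_ℓ ≤ n, searching upward from i (fuel-bounded; μ_ℓ ≥ ℓ so fuel n suffices)
ellF : ℕ → ℕ → ℕ → ℕ
ellF zero    i n = i
ellF (suc f) i n = if μ (suc i) ≤ᵇ n then ellF f (suc i) n else i

ell : ℕ → ℕ
ell n = ellF n 1 n

-- sum of the coefficients ε_i of the greedy μ-expansion (fuel-bounded;
-- each step decreases n by at least μ_1 = 5, so fuel n suffices)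
phiF : ℕ → ℕ → ℕ
phiF zero    n = 0
phiF (suc f) n with n ≤? 4
... | yes _ = 0
... | no  _ =
  let r′ = n ∸ μ (ell n) in
  if r′ ≡ᵇ 0 then 1
  else if r′ ≡ᵇ μ (ell n) then 2
  else suc (phiF f r′)

φ : ℕ → ℕ
φ n = phiF n n

-- The partial sums are self-similar: A_{k+2} = A_{k+1} A_{k+1} (1), so with
-- M = M_{k+1} and μ = μ_{k+1} = 3M + 2 = s_M one has s_{M+q} = μ + s_q for q ≤ M.
-- If μ ≤ m < μ_{k+2} = 2μ + 1 and m = μ + r′, then s⁻¹(m) is M when r′ = 0,
-- 2M when r′ = μ, and M + s⁻¹(r′) otherwise.  Each greedy step therefore
-- removes μ = 3M + 2 from m, 3M from 3 s⁻¹(m) and 2 from 2 φ(m), and the final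
-- remainder r ≤ 4 lies below s_1 = 5, so s⁻¹(r) = 0.
module Submission where

open import Defs
open import Data.Nat using (ℕ; zero; suc; _+_; _*_; _∸_; _^_; _≤_; _<_; _≤′_; _≤?_; _≤ᵇ_; _≡ᵇ_; z≤n; s≤s; ≤′-refl; ≤′-step)
open import Data.Nat.Properties
open import Data.Nat.Tactic.RingSolver using (solve-∀)
open import Data.Bool using (true; false; T)
open import Data.Unit using (tt)
open import Data.List using (List; []; _∷_; _++_; length)
open import Data.List.Properties using (length-++)
open import Data.List.Relation.Unary.All using (All; []; _∷_)
open import Data.List.Relation.Unary.All.Properties using (++⁺)
open import Data.Product using (_×_; _,_; proj₂; ∃-syntax)
open import Data.Sum using (inj₁; inj₂)
open import Data.Empty using (⊥-elim)
open import Relation.Nullary using (yes; no)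
open import Relation.Binary.PropositionalEquality using (_≡_; refl; sym; trans; cong; cong₂; subst; module ≡-Reasoning)

blockLength : ℕ → ℕ
blockLength k = length (Ablock k)

-- blockLength k = M_{k+1}, and blockSum k = μ_{k+1} (see μ-suc and s-blockLength).
blockSum : ℕ → ℕ
blockSum zero    = 5
blockSum (suc k) = blockSum k + (blockSum k + 1)

blockLength-suc : ∀ k → blockLength (suc k) ≡ blockLength k + (blockLength k + 1)
blockLength-suc k = trans (length-++ (Ablock k)) (cong (blockLength k +_) (length-++ (Ablock k)))

blockSum≡3*blockLength+2 : ∀ k → blockSum k ≡ 3 * blockLength k + 2
blockSum≡3*blockLength+2 zero = refl
blockSum≡3*blockLength+2 (suc k) = begin
  blockSum k + (blockSum k + 1)     ≡⟨ cong (λ w → w + (w + 1)) (blockSum≡3*blockLength+2 k) ⟩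
  (3 * l + 2) + ((3 * l + 2) + 1)   ≡⟨ identity l ⟩
  3 * (l + (l + 1)) + 2             ≡⟨ cong (λ x → 3 * x + 2) (sym (blockLength-suc k)) ⟩
  3 * blockLength (suc k) + 2       ∎
  where
  open ≡-Reasoning
  l = blockLength k
  identity : ∀ x → (3 * x + 2) + ((3 * x + 2) + 1) ≡ 3 * (x + (x + 1)) + 2
  identity = solve-∀

blockSum+1≡3*2^suc : ∀ k → blockSum k + 1 ≡ 3 * 2 ^ suc k
blockSum+1≡3*2^suc zero = refl
blockSum+1≡3*2^suc (suc k) = begin
  blockSum k + (blockSum k + 1) + 1 ≡⟨ double (blockSum k) ⟩
  2 * (blockSum k + 1)              ≡⟨ cong (2 *_) (blockSum+1≡3*2^suc k) ⟩
  2 * (3 * 2 ^ suc k)               ≡⟨ swap (2 ^ suc k) ⟩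
  3 * 2 ^ suc (suc k)               ∎
  where
  open ≡-Reasoning
  double : ∀ x → x + (x + 1) + 1 ≡ 2 * (x + 1)
  double = solve-∀
  swap : ∀ x → 2 * (3 * x) ≡ 3 * (2 * x)
  swap = solve-∀

μ-suc : ∀ k → μ (suc k) ≡ blockSum k
μ-suc k = trans (cong (_∸ 1) (sym (blockSum+1≡3*2^suc k))) (m+n∸n≡m (blockSum k) 1)

n<blockSum : ∀ n → n < blockSum n
n<blockSum zero    = s≤s z≤n
n<blockSum (suc n) = ≤-trans (s≤s (n<blockSum n)) (≤-trans (≤-reflexive (+-comm 1 (blockSum n))) (m≤n+m (blockSum n + 1) (blockSum n)))

5≤blockSum : ∀ k → 5 ≤ blockSum k
5≤blockSum zero    = ≤-refl
5≤blockSum (suc k) = ≤-trans (5≤blockSum k) (m≤m+n _ _)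

k<blockLength : ∀ k → k < blockLength k
k<blockLength zero = s≤s z≤n
k<blockLength (suc k) rewrite blockLength-suc k =
  ≤-trans (s≤s (k<blockLength k)) (≤-trans (≤-reflexive (+-comm 1 (blockLength k))) (m≤n+m (blockLength k + 1) (blockLength k)))

blockLength-mono : ∀ {k k′} → k ≤′ k′ → blockLength k ≤ blockLength k′
blockLength-mono ≤′-refl = ≤-refl
blockLength-mono {k′ = suc k′} (≤′-step p) rewrite blockLength-suc k′ = ≤-trans (blockLength-mono p) (m≤m+n _ _)

nth-++ˡ : ∀ (xs ys : List ℕ) {i} → i < length xs → nth (xs ++ ys) i ≡ nth xs i
nth-++ˡ (x ∷ xs) ys {zero}  _         = refl
nth-++ˡ (x ∷ xs) ys {suc i} (s≤s i<n) = nth-++ˡ xs ys i<n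

nth-++ʳ : ∀ (xs ys : List ℕ) i → nth (xs ++ ys) (length xs + i) ≡ nth ys i
nth-++ʳ []       ys i = refl
nth-++ʳ (x ∷ xs) ys i = nth-++ʳ xs ys i

nth-All : ∀ {P : ℕ → Set} {xs} i → All P xs → i < length xs → P (nth xs i)
nth-All zero    (px ∷ _)   _         = px
nth-All (suc i) (_ ∷ pxs) (s≤s i<n) = nth-All i pxs i<n

nth-Ablock-stable : ∀ {k k′} i → k ≤′ k′ → i < blockLength k → nth (Ablock k′) i ≡ nth (Ablock k) i
nth-Ablock-stable i ≤′-refl _ = refl
nth-Ablock-stable {k′ = suc k′} i (≤′-step p) i<l =
  trans (nth-++ˡ (Ablock k′) _ (<-≤-trans i<l (blockLength-mono p))) (nth-Ablock-stable i p i<l)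

a≡nth-Ablock : ∀ k i → i < blockLength k → a (suc i) ≡ nth (Ablock k) i
a≡nth-Ablock k i i<l with ≤-total k (suc i)
... | inj₁ k≤ = nth-Ablock-stable i (≤⇒≤′ k≤) i<l
... | inj₂ ≤k = sym (nth-Ablock-stable i (≤⇒≤′ ≤k) (<-trans (n<1+n i) (k<blockLength (suc i))))

a-periodic : ∀ k q → q < blockLength k → a (suc (blockLength k + q)) ≡ a (suc q)
a-periodic k q q<l = begin
  a (suc (blockLength k + q))                              ≡⟨ a≡nth-Ablock (suc k) _ lt ⟩
  nth (Ablock k ++ Ablock k ++ 1 ∷ []) (blockLength k + q) ≡⟨ nth-++ʳ (Ablock k) _ q ⟩
  nth (Ablock k ++ 1 ∷ []) q                               ≡⟨ nth-++ˡ (Ablock k) _ q<l ⟩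
  nth (Ablock k) q                                         ≡⟨ sym (a≡nth-Ablock k q q<l) ⟩
  a (suc q)                                                ∎
  where
  open ≡-Reasoning
  lt : blockLength k + q < blockLength (suc k)
  lt rewrite blockLength-suc k = +-monoʳ-< (blockLength k) (≤-trans q<l (m≤m+n _ 1))

a-separator : ∀ k → a (suc (blockLength k + blockLength k)) ≡ 1
a-separator k = begin
  a (suc (l + l))                              ≡⟨ a≡nth-Ablock (suc k) (l + l) lt ⟩
  nth (Ablock k ++ Ablock k ++ 1 ∷ []) (l + l) ≡⟨ nth-++ʳ (Ablock k) _ l ⟩
  nth (Ablock k ++ 1 ∷ []) l                   ≡⟨ cong (nth (Ablock k ++ 1 ∷ [])) (sym (+-identityʳ l)) ⟩
  nth (Ablock k ++ 1 ∷ []) (l + 0)             ≡⟨ nth-++ʳ (Ablock k) _ 0 ⟩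
  1                                            ∎
  where
  open ≡-Reasoning
  l = blockLength k
  lt : l + l < blockLength (suc k)
  lt rewrite blockLength-suc k = +-monoʳ-< l (≤-reflexive (+-comm 1 l))

Ablock-positive : ∀ k → All (1 ≤_) (Ablock k)
Ablock-positive zero    = s≤s z≤n ∷ []
Ablock-positive (suc k) = ++⁺ (Ablock-positive k) (++⁺ (Ablock-positive k) (s≤s z≤n ∷ []))

a-positive : ∀ n → 1 ≤ a (suc n)
a-positive n = nth-All n (Ablock-positive (suc n)) (<-trans (n<1+n n) (k<blockLength (suc n)))

s-mono : ∀ {i j} → i ≤ j → s i ≤ s j
s-mono {i} i≤j = go (≤⇒≤′ i≤j)
  where
  go : ∀ {j} → i ≤′ j → s i ≤ s j
  go ≤′-refl     = ≤-refl
  go (≤′-step p) = ≤-trans (go p) (m≤m+n _ _)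

s-cancel-< : ∀ {i j} → s i < s j → i < j
s-cancel-< s<s = ≰⇒> (λ j≤i → <⇒≱ s<s (s-mono j≤i))

s<s-suc : ∀ n → s n < s (suc n)
s<s-suc n = subst (_≤ s (suc n)) (+-comm (s n) 1) (+-monoʳ-≤ (s n) (a-positive n))

mutual
  s-blockLength : ∀ k → s (blockLength k) ≡ blockSum k
  s-blockLength zero    = refl
  s-blockLength (suc k) = begin
    s (blockLength (suc k))     ≡⟨ cong s (trans (blockLength-suc k) (trans (cong (l +_) (+-comm l 1)) (+-suc l l))) ⟩
    s (l + l) + a (suc (l + l)) ≡⟨ cong₂ _+_ (s-shift k l ≤-refl) (a-separator k) ⟩
    blockSum k + s l + 1        ≡⟨ cong (λ x → blockSum k + x + 1) (s-blockLength k) ⟩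
    blockSum k + blockSum k + 1 ≡⟨ +-assoc (blockSum k) (blockSum k) 1 ⟩
    blockSum (suc k)            ∎
    where
    open ≡-Reasoning
    l = blockLength k

  s-shift : ∀ k q → q ≤ blockLength k → s (blockLength k + q) ≡ blockSum k + s q
  s-shift k zero    _   = trans (cong s (+-identityʳ (blockLength k))) (trans (s-blockLength k) (sym (+-identityʳ (blockSum k))))
  s-shift k (suc q) q<l = begin
    s (blockLength k + suc q)                           ≡⟨ cong s (+-suc (blockLength k) q) ⟩
    s (blockLength k + q) + a (suc (blockLength k + q)) ≡⟨ cong₂ _+_ (s-shift k q (<⇒≤ q<l)) (a-periodic k q q<l) ⟩
    blockSum k + s q + a (suc q)                        ≡⟨ +-assoc (blockSum k) (s q) _ ⟩
    blockSum k + s (suc q)                              ∎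
    where open ≡-Reasoning

s-double-block : ∀ k → s (blockLength k + blockLength k) ≡ blockSum k + blockSum k
s-double-block k = trans (s-shift k _ ≤-refl) (cong (blockSum k +_) (s-blockLength k))

sInv-below : ∀ {m n j} → IsSInv m n → m < s j → n < j
sInv-below (sn≤m , _) m<sj = s-cancel-< (≤-<-trans sn≤m m<sj)

sInv-small : ∀ {m n} → m ≤ 4 → IsSInv m n → n ≡ 0
sInv-small m≤4 inv = n<1⇒n≡0 (sInv-below {j = 1} inv (s≤s m≤4))

sInv-at-s : ∀ {j n} → IsSInv (s j) n → n ≡ j
sInv-at-s {j} inv = ≤-antisym (≤-pred (sInv-below inv (s<s-suc j))) (proj₂ inv j ≤-refl)

sInv-shift : ∀ {k r n} → r < blockSum k → IsSInv (blockSum k + r) n →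
             ∃[ q ] (n ≡ blockLength k + q × IsSInv r q)
sInv-shift {k} {r} {n} r<b inv@(sn≤ , max) = q , n≡ , sq≤r , max′
  where
  l = blockLength k
  b = blockSum k
  l≤n : l ≤ n
  l≤n = max l (≤-trans (≤-reflexive (s-blockLength k)) (m≤m+n b r))
  q = n ∸ l
  n≡ : n ≡ l + q
  n≡ = sym (m+[n∸m]≡n l≤n)
  q<l : q < l
  q<l = +-cancelˡ-< l q l (subst (_< l + l) n≡
          (sInv-below inv (subst (b + r <_) (sym (s-double-block k)) (+-monoʳ-< b r<b))))
  sq≤r : s q ≤ r
  sq≤r = +-cancelˡ-≤ b (s q) r (subst (_≤ b + r) (trans (cong s n≡) (s-shift k q (<⇒≤ q<l))) sn≤)
  max′ : ∀ j → s j ≤ r → j ≤ q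
  max′ j sj≤r = +-cancelˡ-≤ l j q (subst (l + j ≤_) n≡ (max (l + j)
    (subst (_≤ b + r) (sym (s-shift k j (<⇒≤ j<l))) (+-monoʳ-≤ b sj≤r))))
    where
    j<l : j < l
    j<l = s-cancel-< (<-≤-trans (≤-<-trans sj≤r r<b) (≤-reflexive (sym (s-blockLength k))))

ellF-spec : ∀ f k n → blockSum k ≤ n → n < blockSum (f + k) →
            ∃[ j ] (ellF f (suc k) n ≡ suc j × blockSum j ≤ n × n < blockSum (suc j))
ellF-spec zero    k n lo hi = ⊥-elim (<⇒≱ hi lo)
ellF-spec (suc f) k n lo hi rewrite μ-suc (suc k) with blockSum (suc k) ≤ᵇ n in eq
... | true  = ellF-spec f (suc k) n (≤ᵇ⇒≤ _ n (subst T (sym eq) tt))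
                (subst (λ i → n < blockSum i) (sym (+-suc f k)) hi)
... | false = k , refl , lo , ≰⇒> (λ le → subst T eq (≤⇒≤ᵇ le))

ell-spec : ∀ n → 5 ≤ n → ∃[ j ] (ell n ≡ suc j × blockSum j ≤ n × n < blockSum (suc j))
ell-spec n 5≤n = ellF-spec n 0 n 5≤n (subst (λ i → n < blockSum i) (sym (+-identityʳ n)) (n<blockSum n))

below-μ₁ : ∀ {m n} → m ≤ 4 → IsSInv m n → ∃[ r ] (r ≤ 4 × m ≡ r + (3 * n + 2 * 0))
below-μ₁ {m} m≤4 inv rewrite sInv-small m≤4 inv = m , m≤4 , sym (+-identityʳ m)

single-block : ∀ k {m n} → blockSum k ≡ m → IsSInv m n → m ≡ 3 * n + 2 * 1
single-block k {n = n} refl inv = begin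
  blockSum k            ≡⟨ blockSum≡3*blockLength+2 k ⟩
  3 * blockLength k + 2 ≡⟨ cong (λ i → 3 * i + 2) (sym n≡l) ⟩
  3 * n + 2             ∎
  where
  open ≡-Reasoning
  n≡l : n ≡ blockLength k
  n≡l = sInv-at-s (subst (λ m → IsSInv m n) (sym (s-blockLength k)) inv)

double-block : ∀ k {m n} → blockSum k + blockSum k ≡ m → IsSInv m n → m ≡ 3 * n + 2 * 2
double-block k {n = n} refl inv = begin
  blockSum k + blockSum k   ≡⟨ cong (λ b → b + b) (blockSum≡3*blockLength+2 k) ⟩
  (3 * l + 2) + (3 * l + 2) ≡⟨ identity l ⟩
  3 * (l + l) + 4           ≡⟨ cong (λ i → 3 * i + 4) (sym n≡2l) ⟩
  3 * n + 4                 ∎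
  where
  open ≡-Reasoning
  l = blockLength k
  n≡2l : n ≡ l + l
  n≡2l = sInv-at-s (subst (λ m → IsSInv m n) (sym (s-double-block k)) inv)
  identity : ∀ x → (3 * x + 2) + (3 * x + 2) ≡ 3 * (x + x) + 4
  identity = solve-∀

prepend-block : ∀ k {r m q φ} → m ≡ r + (3 * q + 2 * φ) →
                blockSum k + m ≡ r + (3 * (blockLength k + q) + 2 * suc φ)
prepend-block k {r} {q = q} {φ} refl =
  trans (cong (_+ (r + (3 * q + 2 * φ))) (blockSum≡3*blockLength+2 k)) (identity (blockLength k) r q φ)
  where
  identity : ∀ l r q φ → 3 * l + 2 + (r + (3 * q + 2 * φ)) ≡ r + (3 * (l + q) + 2 * suc φ)
  identity = solve-∀

phiF-sInv : ∀ f m n → m ≤ f → IsSInv m n → ∃[ r ] (r ≤ 4 × m ≡ r + (3 * n + 2 * phiF f m))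
phiF-sInv zero    m n m≤0 inv = below-μ₁ (≤-trans m≤0 z≤n) inv
phiF-sInv (suc f) m n m≤f inv with m ≤? 4
... | yes m≤4 = below-μ₁ m≤4 inv
... | no  m≰4 with ell-spec m (≰⇒> m≰4)
... | k , ell≡ , lo , hi rewrite ell≡ | μ-suc k with m ∸ blockSum k | m+[n∸m]≡n lo
... | zero  | b+0≡m = 0 , z≤n , single-block k (trans (sym (+-identityʳ (blockSum k))) b+0≡m) inv
... | suc r | b+r≡m with suc r ≡ᵇ blockSum k in eq
... | true  = 0 , z≤n , double-block k (trans (cong (blockSum k +_) (sym r≡b)) b+r≡m) inv
  where
  r≡b = ≡ᵇ⇒≡ (suc r) (blockSum k) (subst T (sym eq) tt)
... | false with sInv-shift {k} r<b (subst (λ m → IsSInv m n) (sym b+r≡m) inv)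
  where
  r≤b : suc r ≤ blockSum k
  r≤b = m<1+n⇒m≤n (subst (suc r <_) (+-comm (blockSum k) 1)
          (+-cancelˡ-< (blockSum k) _ _ (subst (_< blockSum (suc k)) (sym b+r≡m) hi)))
  r<b : suc r < blockSum k
  r<b = ≤∧≢⇒< r≤b (λ r≡b → subst T eq (≡⇒≡ᵇ (suc r) (blockSum k) r≡b))
... | q , n≡ , invq with phiF-sInv f (suc r) q r≤f invq
  where
  r≤f : suc r ≤ f
  r≤f = ≤-pred (≤-trans (subst (suc r <_) b+r≡m (m<n+m (suc r) (≤-trans (s≤s z≤n) (5≤blockSum k)))) m≤f)
... | r₀ , r₀≤4 , r≡ = r₀ , r₀≤4 , (begin
  m                                             ≡⟨ sym b+r≡m ⟩
  blockSum k + suc r                            ≡⟨ prepend-block k {r₀} {q = q} {φ′} r≡ ⟩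
  r₀ + (3 * (blockLength k + q) + 2 * suc φ′)  ≡⟨ cong (λ i → r₀ + (3 * i + 2 * suc φ′)) (sym n≡) ⟩
  r₀ + (3 * n + 2 * suc φ′)                     ∎)
  where
  open ≡-Reasoning
  φ′ = phiF f (suc r)

theorem5p1 : ∀ (m : ℕ) → 1 ≤ m → ∀ (n : ℕ) → IsSInv m n →
    ∃[ r ] (r ≤ 4 × m ≡ r + (3 * n + 2 * φ m))
theorem5p1 m _ n = phiF-sInv m m n ≤-refl
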